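{- For any $\sigma,\tau\in\mathbb{T}$ such that $[\![\sigma]\!]$ and $[\![\tau]\!]$ are defined, $\sigma=\tau$ (in $\mathbb{T}$) if and only if $[\![\sigma]\!]=[\![\tau]\!]$ (in $\mathbb{T}_C$).
   Context: Types $\mathbb{T}$: $\sigma::=a\mid\omega\mid\sigma\to\sigma\mid\sigma\cap\sigma\mid\rho$; record types $\rho::=\langle\rangle\mid\langle l:\sigma\rangle\mid\rho+\rho\mid\rho\cap\rho$. Subtyping on $\mathbb{T}$ is the least preorder with: $\sigma\le\omega$; $\omega\le\omega\to\omega$; $\sigma\cap\tau\le\sigma,\tau$; $\sigma\le\tau_1,\sigma\le\tau_2\Rightarrow\sigma\le\tau_1\cap\tau_2$; $(\sigma\to\tau_1)\cap(\sigma\to\tau_2)\le\sigma\to\tau_1\cap\tau_2$; $\sigma_2\le\sigma_1,\tau_1\le\tau_2\Rightarrow\sigma_1\to\tau_1\le\sigma_2\to\tau_2$; $\langle l:\sigma\rangle\le\langle\rangle$; $\langle l:\sigma\rangle\cap\langle l:\tau\rangle\le\langle l:\sigma\cap\tau\rangle$; $\sigma\le\tau\Rightarrow\langle l:\sigma\rangle\le\langle l:\tau\rangle$; $\rho+\langle\rangle=\langle\rangle+\rho=\rho$; $(\rho_1+\rho_2)+\rho_3=\rho_1+(\rho_2+\rho_3)$; $(\rho_1\cap\rho_2)+\rho_3=(\rho_1+\rho_3)\cap(\rho_2+\rho_3)$; $\langle l:\sigma\rangle+(\langle l:\tau\rangle\cap\rho)=\langle l:\tau\rangle\cap\rho$;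 $\langle l:\sigma\rangle+(\langle l':\tau\rangle\cap\rho)=\langle l':\tau\rangle\cap(\langle l:\sigma\rangle+\rho)$ for $l\ne l'$; $\rho_1\le\rho_2\Rightarrow\rho_1+\rho\le\rho_2+\rho$; $\rho_1=\rho_2\Rightarrow\rho+\rho_1=\rho+\rho_2$; here $=$ means mutual $\le$. Types $\mathbb{T}_C$: $\tau::=a\mid\alpha\mid\omega\mid\tau\to\tau\mid\tau\cap\tau\mid c(\tau)$, with subtyping given by the arrow/intersection/$\omega$ axioms above plus $\tau_1\le\tau_2\Rightarrow c(\tau_1)\le c(\tau_2)$ and $c(\tau_1)\cap c(\tau_2)\le c(\tau_1\cap\tau_2)$; $=$ means mutual $\le$. Translation: fix a finite label set $\mathcal{L}$ and unary constructors $\mathrm{rec}$ and $l$ for $l\in\mathcal{L}$. Partial map $[\![\cdot]\!]:\mathbb{T}\to\mathbb{T}_C$: $[\![\omega]\!]=\omega$, $[\![a]\!]=a$, $[\![\sigma\to\tau]\!]=[\![\sigma]\!]\to[\![\tau]\!]$, $[\![\sigma\cap\tau]\!]=[\![\sigma]\!]\cap[\![\tau]\!]$, $[\![\langle l:\tau\rangle]\!]=\mathrm{rec}(l([\![\tau]\!]))$ for $l\in\mathcal{L}$, $[\![\langle\rangle]\!]=\mathrm{rec}(\omega)$; undefined otherwise (in particular on types containing $+$). -}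

module Defs where

open import Data.Nat using (ℕ)
open import Data.Nat.Properties using (_≟_)
open import Data.Bool using (Bool; true; false; _∧_; if_then_else_)
open import Data.List using (List)
open import Data.List.Membership.DecPropositional _≟_ using (_∈?_)
open import Data.Maybe using (Maybe; just; nothing; _>>=_)
open import Data.Product using (_×_)
open import Relation.Nullary using (¬_; does)
open import Relation.Binary.PropositionalEquality using (_≡_)

Atom : Set
Atom = ℕ

Label : Set
Label = ℕ

-- The Bool index records whether the type is a
-- record type ρ (true) or not (false).  This makes the grammar
--   σ ::= a | ω | σ→σ | σ∩σ | ρ
--   ρ ::= ⟨⟩ | ⟨l:σ⟩ | ρ+ρ | ρ∩ρ
-- exact: σ∩τ is a record type iff both σ and τ are; + only combines
-- record types.

infixr 7 _⇒_
infixl 8 _∩_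
infixl 9 _+_

data Ty : Bool → Set where
  atom : Atom → Ty false
  ω    : Ty false
  _⇒_  : ∀ {b c} → Ty b → Ty c → Ty false
  _∩_  : ∀ {b c} → Ty b → Ty c → Ty (b ∧ c)
  ⟨⟩   : Ty true
  ⟨_∶_⟩ : ∀ {b} → Label → Ty b → Ty true
  _+_  : Ty true → Ty true → Ty true

Rec : Set
Rec = Ty true

-- Subtyping on 𝕋 (the least preorder closed under the listed rules;
-- each equation "A = B" contributes both A ≤ B and B ≤ A).
infix 4 _≤_ _≐_

data _≤_ : ∀ {b c} → Ty b → Ty c → Set where
  ≤-refl  : ∀ {b} {σ : Ty b} → σ ≤ σ
  ≤-trans : ∀ {b c d} {σ : Ty b} {τ : Ty c} {υ : Ty d} → σ ≤ τ → τ ≤ υ → σ ≤ υ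
  ≤-ω     : ∀ {b} {σ : Ty b} → σ ≤ ω
  ω≤ω⇒ω   : ω ≤ ω ⇒ ω
  ∩-≤ˡ    : ∀ {b c} {σ : Ty b} {τ : Ty c} → σ ∩ τ ≤ σ
  ∩-≤ʳ    : ∀ {b c} {σ : Ty b} {τ : Ty c} → σ ∩ τ ≤ τ
  ≤-∩     : ∀ {b c d} {σ : Ty b} {τ₁ : Ty c} {τ₂ : Ty d} →
            σ ≤ τ₁ → σ ≤ τ₂ → σ ≤ τ₁ ∩ τ₂
  ⇒-∩     : ∀ {b c d} {σ : Ty b} {τ₁ : Ty c} {τ₂ : Ty d} →
            (σ ⇒ τ₁) ∩ (σ ⇒ τ₂) ≤ σ ⇒ (τ₁ ∩ τ₂)
  ⇒-mono  : ∀ {b₁ b₂ c₁ c₂} {σ₁ : Ty b₁} {σ₂ : Ty b₂} {τ₁ : Ty c₁} {τ₂ : Ty c₂} →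
            σ₂ ≤ σ₁ → τ₁ ≤ τ₂ → σ₁ ⇒ τ₁ ≤ σ₂ ⇒ τ₂
  fld-≤⟨⟩ : ∀ {b} {l : Label} {σ : Ty b} → ⟨ l ∶ σ ⟩ ≤ ⟨⟩
  fld-∩   : ∀ {b c} {l : Label} {σ : Ty b} {τ : Ty c} →
            ⟨ l ∶ σ ⟩ ∩ ⟨ l ∶ τ ⟩ ≤ ⟨ l ∶ σ ∩ τ ⟩
  fld-mono : ∀ {b c} {l : Label} {σ : Ty b} {τ : Ty c} →
            σ ≤ τ → ⟨ l ∶ σ ⟩ ≤ ⟨ l ∶ τ ⟩
  +⟨⟩-≤ : ∀ {ρ : Rec} → ρ + ⟨⟩ ≤ ρ
  +⟨⟩-≥ : ∀ {ρ : Rec} → ρ ≤ ρ + ⟨⟩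
  ⟨⟩+-≤ : ∀ {ρ : Rec} → ⟨⟩ + ρ ≤ ρ
  ⟨⟩+-≥ : ∀ {ρ : Rec} → ρ ≤ ⟨⟩ + ρ
  +-assoc-≤ : ∀ {ρ₁ ρ₂ ρ₃ : Rec} → (ρ₁ + ρ₂) + ρ₃ ≤ ρ₁ + (ρ₂ + ρ₃)
  +-assoc-≥ : ∀ {ρ₁ ρ₂ ρ₃ : Rec} → ρ₁ + (ρ₂ + ρ₃) ≤ (ρ₁ + ρ₂) + ρ₃
  ∩+-≤ : ∀ {ρ₁ ρ₂ ρ₃ : Rec} → (ρ₁ ∩ ρ₂) + ρ₃ ≤ (ρ₁ + ρ₃) ∩ (ρ₂ + ρ₃)
  ∩+-≥ : ∀ {ρ₁ ρ₂ ρ₃ : Rec} → (ρ₁ + ρ₃) ∩ (ρ₂ + ρ₃) ≤ (ρ₁ ∩ ρ₂) + ρ₃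
  over-≤ : ∀ {b c} {l : Label} {σ : Ty b} {τ : Ty c} {ρ : Rec} →
           ⟨ l ∶ σ ⟩ + (⟨ l ∶ τ ⟩ ∩ ρ) ≤ ⟨ l ∶ τ ⟩ ∩ ρ
  over-≥ : ∀ {b c} {l : Label} {σ : Ty b} {τ : Ty c} {ρ : Rec} →
           ⟨ l ∶ τ ⟩ ∩ ρ ≤ ⟨ l ∶ σ ⟩ + (⟨ l ∶ τ ⟩ ∩ ρ)
  swap-≤ : ∀ {b c} {l l′ : Label} {σ : Ty b} {τ : Ty c} {ρ : Rec} → ¬ (l ≡ l′) →
           ⟨ l ∶ σ ⟩ + (⟨ l′ ∶ τ ⟩ ∩ ρ) ≤ ⟨ l′ ∶ τ ⟩ ∩ (⟨ l ∶ σ ⟩ + ρ)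
  swap-≥ : ∀ {b c} {l l′ : Label} {σ : Ty b} {τ : Ty c} {ρ : Rec} → ¬ (l ≡ l′) →
           ⟨ l′ ∶ τ ⟩ ∩ (⟨ l ∶ σ ⟩ + ρ) ≤ ⟨ l ∶ σ ⟩ + (⟨ l′ ∶ τ ⟩ ∩ ρ)
  +-monoˡ : ∀ {ρ₁ ρ₂ ρ : Rec} → ρ₁ ≤ ρ₂ → ρ₁ + ρ ≤ ρ₂ + ρ
  +-congʳ-≤ : ∀ {ρ₁ ρ₂ ρ : Rec} → ρ₁ ≤ ρ₂ → ρ₂ ≤ ρ₁ → ρ + ρ₁ ≤ ρ + ρ₂
  +-congʳ-≥ : ∀ {ρ₁ ρ₂ ρ : Rec} → ρ₁ ≤ ρ₂ → ρ₂ ≤ ρ₁ → ρ + ρ₂ ≤ ρ + ρ₁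

_≐_ : ∀ {b c} → Ty b → Ty c → Set
σ ≐ τ = σ ≤ τ × τ ≤ σ

data Con : Set where
  rec : Con
  lab : Label → Con

infixr 7 _⇒C_
infixl 8 _∩C_

data TyC : Set where
  atomC : Atom → TyC
  var   : ℕ → TyC
  ωC    : TyC
  _⇒C_  : TyC → TyC → TyC
  _∩C_  : TyC → TyC → TyC
  con   : Con → TyC → TyC

infix 4 _≤C_ _≐C_

data _≤C_ : TyC → TyC → Set where
  ≤C-refl  : ∀ {σ} → σ ≤C σ
  ≤C-trans : ∀ {σ τ υ} → σ ≤C τ → τ ≤C υ → σ ≤C υ
  ≤C-ω     : ∀ {σ} → σ ≤C ωC
  ω≤Cω⇒ω   : ωC ≤C ωC ⇒C ωC
  ∩C-≤ˡ    : ∀ {σ τ} → σ ∩C τ ≤C σ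
  ∩C-≤ʳ    : ∀ {σ τ} → σ ∩C τ ≤C τ
  ≤C-∩     : ∀ {σ τ₁ τ₂} → σ ≤C τ₁ → σ ≤C τ₂ → σ ≤C τ₁ ∩C τ₂
  ⇒C-∩     : ∀ {σ τ₁ τ₂} → (σ ⇒C τ₁) ∩C (σ ⇒C τ₂) ≤C σ ⇒C (τ₁ ∩C τ₂)
  ⇒C-mono  : ∀ {σ₁ σ₂ τ₁ τ₂} → σ₂ ≤C σ₁ → τ₁ ≤C τ₂ → σ₁ ⇒C τ₁ ≤C σ₂ ⇒C τ₂
  con-mono : ∀ {c τ₁ τ₂} → τ₁ ≤C τ₂ → con c τ₁ ≤C con c τ₂
  con-∩    : ∀ {c τ₁ τ₂} → con c τ₁ ∩C con c τ₂ ≤C con c (τ₁ ∩C τ₂)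

_≐C_ : TyC → TyC → Set
σ ≐C τ = σ ≤C τ × τ ≤C σ

⟦_⟧ : ∀ {b} → Ty b → List Label → Maybe TyC
⟦ atom a ⟧ 𝓛 = just (atomC a)
⟦ ω ⟧ 𝓛 = just ωC
⟦ σ ⇒ τ ⟧ 𝓛 = ⟦ σ ⟧ 𝓛 >>= λ s → ⟦ τ ⟧ 𝓛 >>= λ t → just (s ⇒C t)
⟦ σ ∩ τ ⟧ 𝓛 = ⟦ σ ⟧ 𝓛 >>= λ s → ⟦ τ ⟧ 𝓛 >>= λ t → just (s ∩C t)
⟦ ⟨⟩ ⟧ 𝓛 = just (con rec ωC)
⟦ ⟨ l ∶ τ ⟩ ⟧ 𝓛 =
  if does (l ∈? 𝓛)
  then (⟦ τ ⟧ 𝓛 >>= λ t → just (con rec (con (lab l) t)))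
  else nothing
⟦ ρ₁ + ρ₂ ⟧ 𝓛 = nothing

-- Extend ⟦·⟧ to a total translation ⟦·⟧⁺ by reading ρ₁ + ρ₂ as rec applied
-- to the fields of ρ₂ overriding those of ρ₁: every field of ρ₁ whose label
-- ρ₂ also declares is replaced by ω.  Each axiom of 𝕋 then holds after
-- translation, so ⟦·⟧⁺ is monotone.  Conversely, a monotone decoding of 𝕋_C
-- back into 𝕋 is a left inverse of ⟦·⟧⁺ up to = on +-free types, so ⟦·⟧⁺
-- also reflects ≤ there.  Finally ⟦σ⟧ is defined only when σ is +-free, and
-- then it coincides with ⟦σ⟧⁺.
module Submission where

open import Defs
open import Data.Bool using (Bool; true; false; _∧_; _∨_; not; if_then_else_)
open import Data.Bool.Properties
  using (∧-distribʳ-∨; ∨-distribʳ-∧; ∨-inverseˡ; ∧-identityʳ; ∧-zeroʳ; ∨-zeroʳ)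
open import Data.Empty using (⊥)
open import Data.List using (List)
open import Data.Maybe using (Maybe; just; _>>=_)
open import Data.Nat.Properties using (_≟_)
open import Data.List.Membership.DecPropositional _≟_ using (_∈?_)
open import Data.Product using (Σ; _×_; _,_; proj₁; proj₂)
open import Data.Unit using (⊤; tt)
open import Relation.Binary.PropositionalEquality
  using (_≡_; refl; sym; trans; cong; cong₂; module ≡-Reasoning)
open import Relation.Nullary using (¬_; does; yes; no)
open import Relation.Nullary.Decidable using (dec-true; dec-false)

≤C-reflexive : ∀ {x y} → x ≡ y → x ≤C y
≤C-reflexive refl = ≤C-refl

∩C-mono : ∀ {x₁ x₂ y₁ y₂} → x₁ ≤C x₂ → y₁ ≤C y₂ → x₁ ∩C y₁ ≤C x₂ ∩C y₂
∩C-mono p q = ≤C-∩ (≤C-trans ∩C-≤ˡ p) (≤C-trans ∩C-≤ʳ q)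

∩C-assoc : ∀ x y z → (x ∩C y) ∩C z ≐C x ∩C (y ∩C z)
∩C-assoc x y z = ≤C-∩ (≤C-trans ∩C-≤ˡ ∩C-≤ˡ) (∩C-mono ∩C-≤ʳ ≤C-refl)
               , ≤C-∩ (∩C-mono ≤C-refl ∩C-≤ˡ) (≤C-trans ∩C-≤ʳ ∩C-≤ʳ)

∩C-left-comm : ∀ x y z → x ∩C (y ∩C z) ≤C y ∩C (x ∩C z)
∩C-left-comm x y z = ≤C-∩ (≤C-trans ∩C-≤ʳ ∩C-≤ˡ) (∩C-mono ≤C-refl ∩C-≤ʳ)

-- A record body is an intersection of fields con (lab l) t.

declares : TyC → Label → Bool
declares (x ∩C y)         l = declares x l ∨ declares y l
declares (con (lab l′) t) l = does (l′ ≟ l)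
declares _                l = false

erase : (Label → Bool) → TyC → TyC
erase f (x ∩C y)         = erase f x ∩C erase f y
erase f (con (lab l) t)  = if f l then ωC else con (lab l) t
erase f x                = x

override : TyC → TyC → TyC
override a b = erase (declares b) a ∩C b

declares-antimono : ∀ {x y l} → x ≤C y → declares y l ≡ true → declares x l ≡ true
declares-antimono ≤C-refl                    e = e
declares-antimono (≤C-trans p q)             e = declares-antimono p (declares-antimono q e)
declares-antimono ≤C-ω                       ()
declares-antimono ω≤Cω⇒ω                     ()
declares-antimono ∩C-≤ˡ                      e rewrite e = refl
declares-antimono {σ ∩C τ} {l = l} ∩C-≤ʳ     e = trans (cong (declares σ l ∨_) e) (∨-zeroʳ _)
declares-antimono {l = l} (≤C-∩ {τ₁ = τ₁} p q) e with declares τ₁ l in e₁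
... | true  = declares-antimono p e₁
... | false = declares-antimono q e
declares-antimono ⇒C-∩                       ()
declares-antimono (⇒C-mono p q)              ()
declares-antimono (con-mono {c = rec} p)     ()
declares-antimono (con-mono {c = lab _} p)   e = e
declares-antimono (con-∩ {c = rec})          ()
declares-antimono (con-∩ {c = lab _})        e rewrite e = refl

declares-cong : ∀ {x y} → x ≐C y → ∀ l → declares x l ≡ declares y l
declares-cong {x} {y} (p , q) l with declares x l in ex | declares y l in ey
... | true  | true  = refl
... | false | false = refl
... | true  | false = trans (sym (declares-antimono q ex)) ey
... | false | true  = trans (sym ex) (declares-antimono p ey)

erase-cong : ∀ {f g} → (∀ l → f l ≡ g l) → ∀ x → erase f x ≡ erase g x
erase-cong f≗g (x ∩C y)        = cong₂ _∩C_ (erase-cong f≗g x) (erase-cong f≗g y)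
erase-cong f≗g (con (lab l) t) = cong (λ v → if v then ωC else con (lab l) t) (f≗g l)
erase-cong f≗g (atomC _)       = refl
erase-cong f≗g (var _)         = refl
erase-cong f≗g ωC              = refl
erase-cong f≗g (_ ⇒C _)        = refl
erase-cong f≗g (con rec _)     = refl

erase-nothing : ∀ x → erase (λ _ → false) x ≡ x
erase-nothing (x ∩C y)        = cong₂ _∩C_ (erase-nothing x) (erase-nothing y)
erase-nothing (con (lab _) _) = refl
erase-nothing (atomC _)       = refl
erase-nothing (var _)         = refl
erase-nothing ωC              = refl
erase-nothing (_ ⇒C _)        = refl
erase-nothing (con rec _)     = refl

erase-erase : ∀ f g x → erase f (erase g x) ≡ erase (λ l → g l ∨ f l) x
erase-erase f g (x ∩C y)        = cong₂ _∩C_ (erase-erase f g x) (erase-erase f g y)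
erase-erase f g (con (lab l) t) with g l
... | true  = refl
... | false = refl
erase-erase f g (atomC _)       = refl
erase-erase f g (var _)         = refl
erase-erase f g ωC              = refl
erase-erase f g (_ ⇒C _)        = refl
erase-erase f g (con rec _)     = refl

erase-mono : ∀ {f x y} → x ≤C y → erase f x ≤C erase f y
erase-mono ≤C-refl           = ≤C-refl
erase-mono (≤C-trans p q)    = ≤C-trans (erase-mono p) (erase-mono q)
erase-mono ≤C-ω              = ≤C-ω
erase-mono ω≤Cω⇒ω            = ω≤Cω⇒ω
erase-mono ∩C-≤ˡ             = ∩C-≤ˡ
erase-mono ∩C-≤ʳ             = ∩C-≤ʳ
erase-mono (≤C-∩ p q)        = ≤C-∩ (erase-mono p) (erase-mono q)
erase-mono ⇒C-∩              = ⇒C-∩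
erase-mono (⇒C-mono p q)     = ⇒C-mono p q
erase-mono (con-mono {c = rec} p) = con-mono p
erase-mono {f} (con-mono {c = lab l} p) with f l
... | true  = ≤C-refl
... | false = con-mono p
erase-mono (con-∩ {c = rec}) = con-∩
erase-mono {f} (con-∩ {c = lab l}) with f l
... | true  = ∩C-≤ˡ
... | false = con-∩

declares-erase : ∀ f x l → declares (erase f x) l ≡ declares x l ∧ not (f l)
declares-erase f (x ∩C y) l =
  trans (cong₂ _∨_ (declares-erase f x l) (declares-erase f y l))
        (sym (∧-distribʳ-∨ (not (f l)) (declares x l) (declares y l)))
declares-erase f (con (lab l′) t) l with l′ ≟ l
... | yes refl with f l′
...   | true  = sym (∧-zeroʳ _)
...   | false = sym (∧-identityʳ _)
declares-erase f (con (lab l′) t) l | no l′≢l with f l′ | dec-false (l′ ≟ l) l′≢l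
...   | true  | l′≠l = cong (_∧ not (f l)) (sym l′≠l)
...   | false | l′≠l = sym (trans (cong (_∧ not (f l)) l′≠l) (sym l′≠l))
declares-erase f (atomC _)   l = refl
declares-erase f (var _)     l = refl
declares-erase f ωC          l = refl
declares-erase f (_ ⇒C _)    l = refl
declares-erase f (con rec _) l = refl

override-identityʳ : ∀ a → override a ωC ≐C a
override-identityʳ a = ≤C-trans ∩C-≤ˡ (≤C-reflexive (erase-nothing a))
                     , ≤C-∩ (≤C-reflexive (sym (erase-nothing a))) ≤C-ω

override-identityˡ : ∀ b → override ωC b ≐C b
override-identityˡ b = ∩C-≤ʳ , ≤C-∩ ≤C-ω ≤C-refl

override-assoc : ∀ a b c → override (override a b) c ≐C override a (override b c)
override-assoc a b c =
    ≤C-trans (proj₁ (∩C-assoc _ _ _)) (∩C-mono (≤C-reflexive erase-twice) ≤C-refl)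
  , ≤C-trans (∩C-mono (≤C-reflexive (sym erase-twice)) ≤C-refl) (proj₂ (∩C-assoc _ _ _))
  where
  absorb : ∀ x y → (x ∧ not y) ∨ y ≡ x ∨ y
  absorb x y = begin
    (x ∧ not y) ∨ y        ≡⟨ ∨-distribʳ-∧ y x (not y) ⟩
    (x ∨ y) ∧ (not y ∨ y)  ≡⟨ cong ((x ∨ y) ∧_) (∨-inverseˡ y) ⟩
    (x ∨ y) ∧ true         ≡⟨ ∧-identityʳ (x ∨ y) ⟩
    x ∨ y                  ∎
    where open ≡-Reasoning

  declares-override : ∀ l → declares b l ∨ declares c l ≡ declares (override b c) l
  declares-override l =
    sym (trans (cong (_∨ declares c l) (declares-erase (declares c) b l))
               (absorb (declares b l) (declares c l)))

  erase-twice : erase (declares c) (erase (declares b) a) ≡ erase (declares (override b c)) a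
  erase-twice = trans (erase-erase (declares c) (declares b) a) (erase-cong declares-override a)

override-∩-distribʳ : ∀ a₁ a₂ b → override (a₁ ∩C a₂) b ≐C override a₁ b ∩C override a₂ b
override-∩-distribʳ a₁ a₂ b = ≤C-∩ (∩C-mono ∩C-≤ˡ ≤C-refl) (∩C-mono ∩C-≤ʳ ≤C-refl)
                            , ≤C-∩ (∩C-mono ∩C-≤ˡ ∩C-≤ˡ) (≤C-trans ∩C-≤ˡ ∩C-≤ʳ)

override-shadow : ∀ l s t r → override (con (lab l) s) (con (lab l) t ∩C r) ≐C con (lab l) t ∩C r
override-shadow l s t r = ∩C-≤ʳ , ≤C-∩ (≤C-trans ≤C-ω (≤C-reflexive (sym erased))) ≤C-refl
  where
  erased : erase (declares (con (lab l) t ∩C r)) (con (lab l) s) ≡ ωC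
  erased = cong (λ v → if v then ωC else con (lab l) s)
                (cong (_∨ declares r l) (dec-true (l ≟ l) refl))

override-swap : ∀ l l′ s t r → ¬ l ≡ l′ →
  override (con (lab l) s) (con (lab l′) t ∩C r) ≐C con (lab l′) t ∩C override (con (lab l) s) r
override-swap l l′ s t r l≢l′ =
    ≤C-trans (∩C-mono (≤C-reflexive erased) ≤C-refl) (∩C-left-comm _ _ _)
  , ≤C-trans (∩C-left-comm _ _ _) (∩C-mono (≤C-reflexive (sym erased)) ≤C-refl)
  where
  erased : erase (declares (con (lab l′) t ∩C r)) (con (lab l) s) ≡ erase (declares r) (con (lab l) s)
  erased = cong (λ v → if v then ωC else con (lab l) s)
                (cong (_∨ declares r l) (dec-false (l′ ≟ l) (λ l′≡l → l≢l′ (sym l′≡l))))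

override-monoˡ : ∀ {a₁ a₂} b → a₁ ≤C a₂ → override a₁ b ≤C override a₂ b
override-monoˡ b p = ∩C-mono (erase-mono p) ≤C-refl

override-congʳ : ∀ a {b₁ b₂} → b₁ ≐C b₂ → override a b₁ ≤C override a b₂
override-congʳ a b₁=b₂ = ∩C-mono (≤C-reflexive (erase-cong (declares-cong b₁=b₂) a)) (proj₁ b₁=b₂)

fields : TyC → TyC
fields (con rec t) = t
fields (x ∩C y)    = fields x ∩C fields y
fields _           = ωC

⟦_⟧⁺ : ∀ {b} → Ty b → TyC
⟦ atom a ⟧⁺    = atomC a
⟦ ω ⟧⁺         = ωC
⟦ σ ⇒ τ ⟧⁺     = ⟦ σ ⟧⁺ ⇒C ⟦ τ ⟧⁺
⟦ σ ∩ τ ⟧⁺     = ⟦ σ ⟧⁺ ∩C ⟦ τ ⟧⁺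
⟦ ⟨⟩ ⟧⁺        = con rec ωC
⟦ ⟨ l ∶ σ ⟩ ⟧⁺ = con rec (con (lab l) ⟦ σ ⟧⁺)
⟦ ρ₁ + ρ₂ ⟧⁺   = con rec (override (fields ⟦ ρ₁ ⟧⁺) (fields ⟦ ρ₂ ⟧⁺))

fields-mono : ∀ {x y} → x ≤C y → fields x ≤C fields y
fields-mono ≤C-refl                = ≤C-refl
fields-mono (≤C-trans p q)         = ≤C-trans (fields-mono p) (fields-mono q)
fields-mono ≤C-ω                   = ≤C-ω
fields-mono ω≤Cω⇒ω                 = ≤C-refl
fields-mono ∩C-≤ˡ                  = ∩C-≤ˡ
fields-mono ∩C-≤ʳ                  = ∩C-≤ʳ
fields-mono (≤C-∩ p q)             = ≤C-∩ (fields-mono p) (fields-mono q)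
fields-mono ⇒C-∩                   = ≤C-ω
fields-mono (⇒C-mono p q)          = ≤C-refl
fields-mono (con-mono {c = rec} p) = p
fields-mono (con-mono {c = lab _} p) = ≤C-refl
fields-mono (con-∩ {c = rec})      = ≤C-refl
fields-mono (con-∩ {c = lab _})    = ≤C-ω

⟦⟧⁺-record : ∀ {b} (ρ : Ty b) → b ≡ true → ⟦ ρ ⟧⁺ ≐C con rec (fields ⟦ ρ ⟧⁺)
⟦⟧⁺-record (_∩_ {true} {true} ρ₁ ρ₂) refl with ⟦⟧⁺-record ρ₁ refl | ⟦⟧⁺-record ρ₂ refl
... | p₁ , q₁ | p₂ , q₂ = ≤C-trans (∩C-mono p₁ p₂) con-∩
                        , ≤C-∩ (≤C-trans (con-mono ∩C-≤ˡ) q₁) (≤C-trans (con-mono ∩C-≤ʳ) q₂)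
⟦⟧⁺-record (_∩_ {true} {false} _ _) ()
⟦⟧⁺-record (_∩_ {false} _ _)        ()
⟦⟧⁺-record ⟨⟩          refl = ≤C-refl , ≤C-refl
⟦⟧⁺-record ⟨ _ ∶ _ ⟩   refl = ≤C-refl , ≤C-refl
⟦⟧⁺-record (_ + _)     refl = ≤C-refl , ≤C-refl
⟦⟧⁺-record (atom _)    ()
⟦⟧⁺-record ω           ()
⟦⟧⁺-record (_ ⇒ _)     ()

fields-≤⇒⟦⟧⁺-≤ : (ρ₁ ρ₂ : Rec) → fields ⟦ ρ₁ ⟧⁺ ≤C fields ⟦ ρ₂ ⟧⁺ → ⟦ ρ₁ ⟧⁺ ≤C ⟦ ρ₂ ⟧⁺
fields-≤⇒⟦⟧⁺-≤ ρ₁ ρ₂ p =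
  ≤C-trans (proj₁ (⟦⟧⁺-record ρ₁ refl)) (≤C-trans (con-mono p) (proj₂ (⟦⟧⁺-record ρ₂ refl)))

⟦⟧⁺-mono : ∀ {b c} {σ : Ty b} {τ : Ty c} → σ ≤ τ → ⟦ σ ⟧⁺ ≤C ⟦ τ ⟧⁺
⟦⟧⁺-mono ≤-refl         = ≤C-refl
⟦⟧⁺-mono (≤-trans p q)  = ≤C-trans (⟦⟧⁺-mono p) (⟦⟧⁺-mono q)
⟦⟧⁺-mono ≤-ω            = ≤C-ω
⟦⟧⁺-mono ω≤ω⇒ω          = ω≤Cω⇒ω
⟦⟧⁺-mono ∩-≤ˡ           = ∩C-≤ˡ
⟦⟧⁺-mono ∩-≤ʳ           = ∩C-≤ʳ
⟦⟧⁺-mono (≤-∩ p q)      = ≤C-∩ (⟦⟧⁺-mono p) (⟦⟧⁺-mono q)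
⟦⟧⁺-mono ⇒-∩            = ⇒C-∩
⟦⟧⁺-mono (⇒-mono p q)   = ⇒C-mono (⟦⟧⁺-mono p) (⟦⟧⁺-mono q)
⟦⟧⁺-mono fld-≤⟨⟩        = con-mono ≤C-ω
⟦⟧⁺-mono (fld-∩ {l = l} {σ} {τ}) = fields-≤⇒⟦⟧⁺-≤ (⟨ l ∶ σ ⟩ ∩ ⟨ l ∶ τ ⟩) ⟨ l ∶ σ ∩ τ ⟩ con-∩
⟦⟧⁺-mono (fld-mono p)   = con-mono (con-mono (⟦⟧⁺-mono p))
⟦⟧⁺-mono (+⟨⟩-≤ {ρ})    = fields-≤⇒⟦⟧⁺-≤ (ρ + ⟨⟩) ρ (proj₁ (override-identityʳ _))
⟦⟧⁺-mono (+⟨⟩-≥ {ρ})    = fields-≤⇒⟦⟧⁺-≤ ρ (ρ + ⟨⟩) (proj₂ (override-identityʳ _))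
⟦⟧⁺-mono (⟨⟩+-≤ {ρ})    = fields-≤⇒⟦⟧⁺-≤ (⟨⟩ + ρ) ρ (proj₁ (override-identityˡ _))
⟦⟧⁺-mono (⟨⟩+-≥ {ρ})    = fields-≤⇒⟦⟧⁺-≤ ρ (⟨⟩ + ρ) (proj₂ (override-identityˡ _))
⟦⟧⁺-mono (+-assoc-≤ {ρ₁} {ρ₂} {ρ₃}) =
  con-mono (proj₁ (override-assoc (fields ⟦ ρ₁ ⟧⁺) (fields ⟦ ρ₂ ⟧⁺) (fields ⟦ ρ₃ ⟧⁺)))
⟦⟧⁺-mono (+-assoc-≥ {ρ₁} {ρ₂} {ρ₃}) =
  con-mono (proj₂ (override-assoc (fields ⟦ ρ₁ ⟧⁺) (fields ⟦ ρ₂ ⟧⁺) (fields ⟦ ρ₃ ⟧⁺)))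
⟦⟧⁺-mono (∩+-≤ {ρ₁} {ρ₂} {ρ₃}) =
  fields-≤⇒⟦⟧⁺-≤ ((ρ₁ ∩ ρ₂) + ρ₃) ((ρ₁ + ρ₃) ∩ (ρ₂ + ρ₃))
               (proj₁ (override-∩-distribʳ (fields ⟦ ρ₁ ⟧⁺) (fields ⟦ ρ₂ ⟧⁺) (fields ⟦ ρ₃ ⟧⁺)))
⟦⟧⁺-mono (∩+-≥ {ρ₁} {ρ₂} {ρ₃}) =
  fields-≤⇒⟦⟧⁺-≤ ((ρ₁ + ρ₃) ∩ (ρ₂ + ρ₃)) ((ρ₁ ∩ ρ₂) + ρ₃)
               (proj₂ (override-∩-distribʳ (fields ⟦ ρ₁ ⟧⁺) (fields ⟦ ρ₂ ⟧⁺) (fields ⟦ ρ₃ ⟧⁺)))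
⟦⟧⁺-mono (over-≤ {l = l} {σ} {τ} {ρ}) =
  fields-≤⇒⟦⟧⁺-≤ (⟨ l ∶ σ ⟩ + (⟨ l ∶ τ ⟩ ∩ ρ)) (⟨ l ∶ τ ⟩ ∩ ρ) (proj₁ (override-shadow l _ _ _))
⟦⟧⁺-mono (over-≥ {l = l} {σ} {τ} {ρ}) =
  fields-≤⇒⟦⟧⁺-≤ (⟨ l ∶ τ ⟩ ∩ ρ) (⟨ l ∶ σ ⟩ + (⟨ l ∶ τ ⟩ ∩ ρ)) (proj₂ (override-shadow l _ _ _))
⟦⟧⁺-mono (swap-≤ {l = l} {l′} {σ} {τ} {ρ} l≢l′) =
  fields-≤⇒⟦⟧⁺-≤ (⟨ l ∶ σ ⟩ + (⟨ l′ ∶ τ ⟩ ∩ ρ)) (⟨ l′ ∶ τ ⟩ ∩ (⟨ l ∶ σ ⟩ + ρ))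
               (proj₁ (override-swap l l′ _ _ _ l≢l′))
⟦⟧⁺-mono (swap-≥ {l = l} {l′} {σ} {τ} {ρ} l≢l′) =
  fields-≤⇒⟦⟧⁺-≤ (⟨ l′ ∶ τ ⟩ ∩ (⟨ l ∶ σ ⟩ + ρ)) (⟨ l ∶ σ ⟩ + (⟨ l′ ∶ τ ⟩ ∩ ρ))
               (proj₂ (override-swap l l′ _ _ _ l≢l′))
⟦⟧⁺-mono (+-monoˡ p)    = con-mono (override-monoˡ _ (fields-mono (⟦⟧⁺-mono p)))
⟦⟧⁺-mono (+-congʳ-≤ {ρ = ρ} p q) =
  con-mono (override-congʳ (fields ⟦ ρ ⟧⁺) (fields-mono (⟦⟧⁺-mono p) , fields-mono (⟦⟧⁺-mono q)))
⟦⟧⁺-mono (+-congʳ-≥ {ρ = ρ} p q) =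
  con-mono (override-congʳ (fields ⟦ ρ ⟧⁺) (fields-mono (⟦⟧⁺-mono q) , fields-mono (⟦⟧⁺-mono p)))

-- decode lands in non-record types, so a record rec(t) is decoded as
-- decodeFields t ∩ ω, which is = to decodeFields t.
-- Constructs outside the image of ⟦·⟧⁺ get arbitrary values keeping decode monotone.

mutual
  decodeFields : TyC → Rec
  decodeFields (x ∩C y)        = decodeFields x ∩ decodeFields y
  decodeFields (con (lab l) t) = ⟨ l ∶ decode t ⟩
  decodeFields _               = ⟨⟩

  decode : TyC → Ty false
  decode (atomC a)       = atom a
  decode (var _)         = ω
  decode ωC              = ω
  decode (x ⇒C y)        = decode x ⇒ decode y
  decode (x ∩C y)        = decode x ∩ decode y
  decode (con rec t)     = decodeFields t ∩ ω
  decode (con (lab l) t) = ⟨ l ∶ decode t ⟩ ∩ ω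

∩-mono : ∀ {b₁ b₂ c₁ c₂} {σ₁ : Ty b₁} {σ₂ : Ty b₂} {τ₁ : Ty c₁} {τ₂ : Ty c₂} →
         σ₁ ≤ σ₂ → τ₁ ≤ τ₂ → σ₁ ∩ τ₁ ≤ σ₂ ∩ τ₂
∩-mono p q = ≤-∩ (≤-trans ∩-≤ˡ p) (≤-trans ∩-≤ʳ q)

decodeFields-≤⟨⟩ : ∀ x → decodeFields x ≤ ⟨⟩
decodeFields-≤⟨⟩ (x ∩C y)        = ≤-trans ∩-≤ˡ (decodeFields-≤⟨⟩ x)
decodeFields-≤⟨⟩ (con (lab _) _) = fld-≤⟨⟩
decodeFields-≤⟨⟩ (atomC _)       = ≤-refl
decodeFields-≤⟨⟩ (var _)         = ≤-refl
decodeFields-≤⟨⟩ ωC              = ≤-refl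
decodeFields-≤⟨⟩ (_ ⇒C _)        = ≤-refl
decodeFields-≤⟨⟩ (con rec _)     = ≤-refl

decode-mono : ∀ {x y} → x ≤C y → (decode x ≤ decode y) × (decodeFields x ≤ decodeFields y)
decode-mono ≤C-refl        = ≤-refl , ≤-refl
decode-mono (≤C-trans p q) = ≤-trans (proj₁ (decode-mono p)) (proj₁ (decode-mono q))
                           , ≤-trans (proj₂ (decode-mono p)) (proj₂ (decode-mono q))
decode-mono {x} ≤C-ω       = ≤-ω , decodeFields-≤⟨⟩ x
decode-mono ω≤Cω⇒ω         = ω≤ω⇒ω , ≤-refl
decode-mono ∩C-≤ˡ          = ∩-≤ˡ , ∩-≤ˡ
decode-mono ∩C-≤ʳ          = ∩-≤ʳ , ∩-≤ʳ
decode-mono (≤C-∩ p q)     = ≤-∩ (proj₁ (decode-mono p)) (proj₁ (decode-mono q))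
                           , ≤-∩ (proj₂ (decode-mono p)) (proj₂ (decode-mono q))
decode-mono ⇒C-∩           = ⇒-∩ , ∩-≤ˡ
decode-mono (⇒C-mono p q)  = ⇒-mono (proj₁ (decode-mono p)) (proj₁ (decode-mono q)) , ≤-refl
decode-mono (con-mono {c = rec} p)   = ∩-mono (proj₂ (decode-mono p)) ≤-refl , ≤-refl
decode-mono (con-mono {c = lab _} p) = ∩-mono (fld-mono (proj₁ (decode-mono p))) ≤-refl
                                     , fld-mono (proj₁ (decode-mono p))
decode-mono (con-∩ {c = rec})   = ≤-∩ (∩-mono ∩-≤ˡ ∩-≤ˡ) ≤-ω , ∩-≤ˡ
decode-mono (con-∩ {c = lab _}) = ≤-∩ (≤-trans (∩-mono ∩-≤ˡ ∩-≤ˡ) fld-∩) ≤-ω , fld-∩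

PlusFree : ∀ {b} → Ty b → Set
PlusFree (atom _)    = ⊤
PlusFree ω           = ⊤
PlusFree (σ ⇒ τ)     = PlusFree σ × PlusFree τ
PlusFree (σ ∩ τ)     = PlusFree σ × PlusFree τ
PlusFree ⟨⟩          = ⊤
PlusFree ⟨ _ ∶ σ ⟩   = PlusFree σ
PlusFree (_ + _)     = ⊥

decode-⟦⟧⁺ : ∀ {b} (σ : Ty b) → PlusFree σ → decode ⟦ σ ⟧⁺ ≐ σ
decode-⟦⟧⁺ (atom _) _ = ≤-refl , ≤-refl
decode-⟦⟧⁺ ω        _ = ≤-refl , ≤-refl
decode-⟦⟧⁺ (σ ⇒ τ) (σ-free , τ-free) with decode-⟦⟧⁺ σ σ-free | decode-⟦⟧⁺ τ τ-free
... | p₁ , q₁ | p₂ , q₂ = ⇒-mono q₁ p₂ , ⇒-mono p₁ q₂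
decode-⟦⟧⁺ (σ ∩ τ) (σ-free , τ-free) with decode-⟦⟧⁺ σ σ-free | decode-⟦⟧⁺ τ τ-free
... | p₁ , q₁ | p₂ , q₂ = ∩-mono p₁ p₂ , ∩-mono q₁ q₂
decode-⟦⟧⁺ ⟨⟩ _ = ∩-≤ˡ , ≤-∩ ≤-refl ≤-ω
decode-⟦⟧⁺ ⟨ l ∶ σ ⟩ σ-free with decode-⟦⟧⁺ σ σ-free
... | p , q = ≤-trans ∩-≤ˡ (fld-mono p) , ≤-∩ (fld-mono q) ≤-ω

⟦⟧⁺-reflects-≤ : ∀ {b c} {σ : Ty b} {τ : Ty c} → PlusFree σ → PlusFree τ →
                 ⟦ σ ⟧⁺ ≤C ⟦ τ ⟧⁺ → σ ≤ τ
⟦⟧⁺-reflects-≤ {σ = σ} {τ} σ-free τ-free p =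
  ≤-trans (proj₂ (decode-⟦⟧⁺ σ σ-free))
          (≤-trans (proj₁ (decode-mono p)) (proj₁ (decode-⟦⟧⁺ τ τ-free)))

bind-just : ∀ {A B : Set} (m : Maybe A) {f : A → Maybe B} {y : B} →
            (m >>= f) ≡ just y → Σ A λ x → m ≡ just x × f x ≡ just y
bind-just (just x) e = x , refl , e

bind₂-just : ∀ {A B C : Set} (m : Maybe A) (n : Maybe B) {g : A → B → C} {y : C} →
             (m >>= λ x → n >>= λ z → just (g x z)) ≡ just y →
             Σ A λ x → Σ B λ z → m ≡ just x × n ≡ just z × g x z ≡ y
bind₂-just (just x) (just z) refl = x , z , refl , refl , refl

⟦⟧-defined : ∀ 𝓛 {b} (σ : Ty b) {s} → ⟦ σ ⟧ 𝓛 ≡ just s → s ≡ ⟦ σ ⟧⁺ × PlusFree σ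
⟦⟧-defined 𝓛 (atom _) refl = refl , tt
⟦⟧-defined 𝓛 ω        refl = refl , tt
⟦⟧-defined 𝓛 ⟨⟩       refl = refl , tt
⟦⟧-defined 𝓛 (σ ⇒ τ) e with bind₂-just (⟦ σ ⟧ 𝓛) (⟦ τ ⟧ 𝓛) e
... | _ , _ , eσ , eτ , refl with ⟦⟧-defined 𝓛 σ eσ | ⟦⟧-defined 𝓛 τ eτ
...   | refl , σ-free | refl , τ-free = refl , σ-free , τ-free
⟦⟧-defined 𝓛 (σ ∩ τ) e with bind₂-just (⟦ σ ⟧ 𝓛) (⟦ τ ⟧ 𝓛) e
... | _ , _ , eσ , eτ , refl with ⟦⟧-defined 𝓛 σ eσ | ⟦⟧-defined 𝓛 τ eτ
...   | refl , σ-free | refl , τ-free = refl , σ-free , τ-free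
⟦⟧-defined 𝓛 ⟨ l ∶ σ ⟩ e with does (l ∈? 𝓛)
... | true with bind-just (⟦ σ ⟧ 𝓛) e
...   | _ , eσ , refl with ⟦⟧-defined 𝓛 σ eσ
...     | refl , σ-free = refl , σ-free
⟦⟧-defined 𝓛 (_ + _) ()

lemma5p1 : (𝓛 : List Label) {b c : Bool} (σ : Ty b) (τ : Ty c) (σ′ τ′ : TyC) →
    ⟦ σ ⟧ 𝓛 ≡ just σ′ → ⟦ τ ⟧ 𝓛 ≡ just τ′ →
    (σ ≐ τ → σ′ ≐C τ′) × (σ′ ≐C τ′ → σ ≐ τ)
lemma5p1 𝓛 σ τ σ′ τ′ σ-defined τ-defined
  with ⟦⟧-defined 𝓛 σ σ-defined | ⟦⟧-defined 𝓛 τ τ-defined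
... | refl , σ-free | refl , τ-free =
    (λ (p , q) → ⟦⟧⁺-mono p , ⟦⟧⁺-mono q)
  , (λ (p , q) → ⟦⟧⁺-reflects-≤ σ-free τ-free p , ⟦⟧⁺-reflects-≤ τ-free σ-free q)
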